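{- Let $s_1,\dots,s_m$ be a sequence of positive integers with $A(s_1,\dots,s_m)\le d$. Then at least $(m-d)/2$ of the $s_j$'s are at least $(m-d)/2$.
   Context: For a sequence of $m$ positive integers $s_1,\dots,s_m$, define $A(s_1,\dots,s_m)=\sum_{j=1}^{m-1}|s_j-s_{j+1}-1|+|s_m-2|$. -}

module Defs where

open import Data.Nat using (ℕ; zero; suc; _+_; _∸_; _*_; _≤_; _<_; _≤?_)
open import Data.Integer using (ℤ; +_; ∣_∣) renaming (_-_ to _-ℤ_)
open import Data.List using (List; []; _∷_; length; filter)

gap : ℕ → ℕ → ℕ
gap a b = ∣ (+ a -ℤ + b) -ℤ + 1 ∣

-- A(s₁,…,sₘ) = Σ_{j<m} |s_j - s_{j+1} - 1| + |s_m - 2|   (sequence nonempty)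
-- For the empty list (not used; the statement requires m ≥ 1) we set A = 0.
A : List ℕ → ℕ
A [] = 0
A (s ∷ []) = ∣ + s -ℤ + 2 ∣
A (s ∷ t ∷ r) = gap s t + A (t ∷ r)

countHalfAtLeast : ℕ → List ℕ → ℕ
countHalfAtLeast k xs = length (filter (λ x → k ≤? 2 * x) xs)

-- Each step s_j → s_{j+1} can drop by more than 1 only by paying for it in A, and the
-- sequence must end near 2; so s_1 ≥ m + 1 − A, and more generally the i-th entry is at
-- least m + 2 − i − d. With K = m − d, the first ⌈K/2⌉ entries are therefore all ≥ K/2.
module Submission where

open import Defs
open import Data.Nat using (ℕ; _≤_; _<_; _∸_; _*_)
open import Data.List using (List; length)
open import Data.List.Relation.Unary.All using (All)

open import Data.Nat using (suc; _+_; z≤n; s≤s; _≤?_; ⌈_/2⌉)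
open import Data.Nat.Properties
open import Data.Nat.Tactic.RingSolver using (solve-∀)
open import Data.Integer as ℤ using (ℤ; +_; ∣_∣; _⊖_)
import Data.Integer.Properties as ℤ
import Data.Integer.Tactic.RingSolver as ℤ
open import Data.List using ([]; _∷_; filter)
open import Data.List.Properties using (filter-accept)
open import Data.Product using (_×_; _,_; proj₁; proj₂)
open import Data.Sum using (inj₁; inj₂)
open import Relation.Nullary using (yes; no)
open import Relation.Binary.PropositionalEquality

n≤m+∣m⊖n∣ : ∀ m n → n ≤ m + ∣ m ⊖ n ∣
n≤m+∣m⊖n∣ m n with m ≤? n
... | yes m≤n = ≤-trans (m≤n+m∸n n m) (≤-reflexive (cong (λ k → m + k) (sym (ℤ.∣⊖∣-≤ m≤n))))
... | no m≰n = ≤-trans (≰⇒≥ m≰n) (m≤m+n m _)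

gap≡∣⊖∣ : ∀ a b → gap a b ≡ ∣ a ⊖ suc b ∣
gap≡∣⊖∣ a b = cong ∣_∣ (trans (x-y-1≡x-[1+y] (+ a) (+ b)) (ℤ.m-n≡m⊖n a (suc b)))
  where
  x-y-1≡x-[1+y] : ∀ (x y : ℤ) → (x ℤ.- y) ℤ.- + 1 ≡ x ℤ.- (+ 1 ℤ.+ y)
  x-y-1≡x-[1+y] = ℤ.solve-∀

suc≤+gap : ∀ a b → suc b ≤ a + gap a b
suc≤+gap a b rewrite gap≡∣⊖∣ a b = n≤m+∣m⊖n∣ a (suc b)

A-tail≤A : ∀ x xs → A xs ≤ A (x ∷ xs)
A-tail≤A x []       = z≤n
A-tail≤A x (y ∷ ys) = m≤n+m (A (y ∷ ys)) (gap x y)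

length<head+A : ∀ x xs → length (x ∷ xs) < x + A (x ∷ xs)
length<head+A x []       = n≤m+∣m⊖n∣ x 2
length<head+A x (y ∷ ys) = begin
  suc (length (x ∷ y ∷ ys))  ≤⟨ s≤s (length<head+A y ys) ⟩
  suc y + A (y ∷ ys)         ≤⟨ +-monoˡ-≤ (A (y ∷ ys)) (suc≤+gap x y) ⟩
  x + gap x y + A (y ∷ ys)   ≡⟨ +-assoc x (gap x y) (A (y ∷ ys)) ⟩
  x + A (x ∷ y ∷ ys)         ∎
  where open ≤-Reasoning

countHalfAtLeast-accept : ∀ {K x} xs → K ≤ 2 * x →
  countHalfAtLeast K (x ∷ xs) ≡ suc (countHalfAtLeast K xs)
countHalfAtLeast-accept {K} xs K≤2x = cong length (filter-accept (λ y → K ≤? 2 * y) K≤2x)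

-- The hypothesis says the first j entries each have twice their lower bound
-- from length<head+A at least K.
≤-countHalfAtLeast : ∀ K j s → j ≤ length s → K + 2 * (j + A s) ≤ 2 * suc (length s) →
  j ≤ countHalfAtLeast K s
≤-countHalfAtLeast K 0       s        _         _     = z≤n
≤-countHalfAtLeast K (suc j) (x ∷ xs) (s≤s j≤l) bound = begin
  suc j                              ≤⟨ s≤s (≤-countHalfAtLeast K j xs j≤l tail-bound) ⟩
  suc (countHalfAtLeast K xs)        ≡⟨ countHalfAtLeast-accept xs head-counted ⟨
  countHalfAtLeast K (x ∷ xs)        ∎
  where
  open ≤-Reasoning
  a : ℕ
  a = A (x ∷ xs)

  head-counted : K ≤ 2 * x
  head-counted = +-cancelʳ-≤ (2 * a) K (2 * x) (begin
    K + 2 * a                  ≤⟨ +-monoʳ-≤ K (*-monoʳ-≤ 2 (m≤n+m a (suc j))) ⟩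
    K + 2 * (suc j + a)        ≤⟨ bound ⟩
    2 * suc (length (x ∷ xs))  ≤⟨ *-monoʳ-≤ 2 (length<head+A x xs) ⟩
    2 * (x + a)                ≡⟨ *-distribˡ-+ 2 x a ⟩
    2 * x + 2 * a              ∎)

  shift : ∀ k i b → 2 + (k + 2 * (i + b)) ≡ k + 2 * (suc i + b)
  shift = solve-∀

  tail-bound : K + 2 * (j + A xs) ≤ 2 * suc (length xs)
  tail-bound = +-cancelˡ-≤ 2 _ _ (begin
    2 + (K + 2 * (j + A xs))   ≤⟨ +-monoʳ-≤ 2 (+-monoʳ-≤ K (*-monoʳ-≤ 2 (+-monoʳ-≤ j (A-tail≤A x xs)))) ⟩
    2 + (K + 2 * (j + a))      ≡⟨ shift K j a ⟩
    K + 2 * (suc j + a)        ≤⟨ bound ⟩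
    2 * suc (suc (length xs))  ≡⟨ *-suc 2 (suc (length xs)) ⟩
    2 + 2 * suc (length xs)    ∎)

⌈n/2⌉-bounds : ∀ n → n ≤ 2 * ⌈ n /2⌉ × 2 * ⌈ n /2⌉ ≤ suc n
⌈n/2⌉-bounds 0             = z≤n , z≤n
⌈n/2⌉-bounds 1             = s≤s z≤n , s≤s (s≤s z≤n)
⌈n/2⌉-bounds (suc (suc n)) with ⌈n/2⌉-bounds n
... | lower , upper rewrite *-suc 2 ⌈ n /2⌉ = s≤s (s≤s lower) , s≤s (s≤s upper)

half-budget : ∀ K a → K + 2 * (⌈ K /2⌉ + a) ≤ 2 * suc (K + a)
half-budget K a = begin
  K + 2 * (c + a)            ≡⟨ regroup K c a ⟩
  2 * c + (K + 2 * a)        ≤⟨ +-monoˡ-≤ (K + 2 * a) (⌈n/2⌉-bounds K .proj₂) ⟩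
  suc K + (K + 2 * a)        ≤⟨ n≤1+n _ ⟩
  suc (suc K + (K + 2 * a))  ≡⟨ double K a ⟩
  2 * suc (K + a)            ∎
  where
  open ≤-Reasoning
  c : ℕ
  c = ⌈ K /2⌉
  regroup : ∀ k i b → k + 2 * (i + b) ≡ 2 * i + (k + 2 * b)
  regroup = solve-∀
  double : ∀ k b → suc (suc k + (k + 2 * b)) ≡ 2 * suc (k + b)
  double = solve-∀

-- Neither nonemptiness nor positivity of the entries is needed.
mainTheorem6 : (s : List ℕ) (d : ℕ) → 1 ≤ length s → All (λ x → 0 < x) s →
    A s ≤ d →
    length s ∸ d ≤ 2 * countHalfAtLeast (length s ∸ d) s
mainTheorem6 s d _ _ A≤d with ≤-total (length s) d
... | inj₁ m≤d rewrite m≤n⇒m∸n≡0 m≤d = z≤n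
... | inj₂ d≤m = ≤-trans (⌈n/2⌉-bounds K .proj₁) (*-monoʳ-≤ 2 (≤-countHalfAtLeast K j s j≤m bound))
  where
  m K j : ℕ
  m = length s
  K = m ∸ d
  j = ⌈ K /2⌉

  j≤m : j ≤ m
  j≤m = ≤-trans (⌈n/2⌉≤n K) (m∸n≤m m d)

  K+A≤m : K + A s ≤ m
  K+A≤m = ≤-trans (+-monoʳ-≤ K A≤d) (≤-reflexive (m∸n+n≡m d≤m))

  bound : K + 2 * (j + A s) ≤ 2 * suc m
  bound = ≤-trans (half-budget K (A s)) (*-monoʳ-≤ 2 (s≤s K+A≤m))
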